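{- Let $q$ be a prime power and $r\ge1$. Let $(E_0,E_1,\dots,E_k)$ and $(F_0,F_1,\dots,F_k)$ be nested sequences of flats in $PG(r-1,q)$ such that $r(E_i)=r(F_i)$ for all $i\in\{0,1,\dots,k\}$. Let $G_E$ be the union of all sets $E_{i+1}-E_i$ and $G_F$ the union of all sets $F_{i+1}-F_i$, taken over the even numbers $i$ with $0\le i\le k-1$. Then $PG(r-1,q)|G_E\cong PG(r-1,q)|G_F$.
   Context: $PG(r-1,q)$ denotes the rank-$r$ projective geometry over $GF(q)$. A nested sequence of flats in $PG(r-1,q)$ is a sequence $(F_0,\dots,F_k)$ of possibly empty flats of $PG(r-1,q)$ with $\emptyset=F_0\subseteq F_1\subseteq\dots\subseteq F_k=E(PG(r-1,q))$. -}

module Defs where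

open import Level using (0ℓ)
open import Algebra.Bundles using (CommutativeRing)
open import Data.Nat using (ℕ; zero; suc; _<_; _≤_) renaming (_*_ to _*ℕ_)
open import Data.Fin using (Fin) renaming (zero to fzero; suc to fsuc)
open import Data.Vec using (Vec; lookup)
open import Data.Product using (Σ; ∃; _×_; _,_)
open import Relation.Nullary using (¬_; Dec)
open import Relation.Binary.PropositionalEquality using (_≡_)

-- A finite field with exactly q elements.  GF(q) is unique up to
-- isomorphism, so quantifying over all such fields is the same as fixing
-- GF(q); such a field exists iff q is a prime power.
record FiniteField (q : ℕ) : Set₁ where
  field
    cring     : CommutativeRing 0ℓ 0ℓ
  open CommutativeRing cring public
  field
    0≉1       : ¬ (0# ≈ 1#)
    inverse   : ∀ x → ¬ (x ≈ 0#) → Σ Carrier (λ y → (x * y) ≈ 1#)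
    _≟F_      : ∀ x y → Dec (x ≈ y)
    elems     : Vec Carrier q
    elems-complete : ∀ x → Σ (Fin q) (λ i → x ≈ lookup elems i)
    elems-distinct : ∀ i j → lookup elems i ≈ lookup elems j → i ≡ j

module PG {q : ℕ} (K : FiniteField q) (r : ℕ) where
  open FiniteField K

  V : Set
  V = Fin r → Carrier

  _≈V_ : V → V → Set
  u ≈V v = ∀ i → u i ≈ v i

  zeroV : V
  zeroV _ = 0#

  _·_ : Carrier → V → V
  (c · v) i = c * v i

  _+V_ : V → V → V
  (u +V v) i = u i + v i

  NonZero : V → Set
  NonZero v = ¬ (v ≈V zeroV)

  SamePoint : V → V → Set
  SamePoint u v = Σ Carrier (λ c → ¬ (c ≈ 0#) × (u ≈V (c · v)))

  record PointSet : Set₁ where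
    field
      mem      : V → Set
      nonzero  : ∀ v → mem v → NonZero v
      resp     : ∀ u v → SamePoint u v → mem v → mem u
  open PointSet public

  _∈P_ : V → PointSet → Set
  v ∈P S = mem S v

  _⊆P_ : PointSet → PointSet → Set
  S ⊆P T = ∀ v → v ∈P S → v ∈P T

  IsEmpty : PointSet → Set
  IsEmpty S = ∀ v → ¬ (v ∈P S)

  IsGround : PointSet → Set
  IsGround S = ∀ v → NonZero v → v ∈P S

  IsFlat : PointSet → Set
  IsFlat S = ∀ u v a b → u ∈P S → v ∈P S →
             NonZero ((a · u) +V (b · v)) → ((a · u) +V (b · v)) ∈P S

  lincomb : ∀ {m} → (Fin m → Carrier) → (Fin m → V) → V
  lincomb {zero}  c vs = zeroV
  lincomb {suc m} c vs = (c fzero · vs fzero) +V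
                         lincomb (λ i → c (fsuc i)) (λ i → vs (fsuc i))

  LinIndep : ∀ {m} → (Fin m → V) → Set
  LinIndep {m} vs = ∀ c → lincomb c vs ≈V zeroV → ∀ i → c i ≈ 0#

  HasRank : PointSet → ℕ → Set
  HasRank S n =
    Σ (Fin n → V) (λ vs → (∀ i → vs i ∈P S) × LinIndep vs)
    × (∀ (vs : Fin (suc n) → V) → (∀ i → vs i ∈P S) → ¬ LinIndep vs)

  -- nested sequence of flats (S_0, ..., S_k), given as S : ℕ → PointSet
  -- (only the indices 0..k matter)
  NestedFlats : ℕ → (ℕ → PointSet) → Set
  NestedFlats k S =
    IsEmpty (S 0) × IsGround (S k)
    × (∀ i → i ≤ k → IsFlat (S i))
    × (∀ i → i < k → S i ⊆P S (suc i))

  evenDiffUnion : ℕ → (ℕ → PointSet) → V → Set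
  evenDiffUnion k S v =
    Σ ℕ (λ j → (2 *ℕ j < k) × (v ∈P S (suc (2 *ℕ j))) × ¬ (v ∈P S (2 *ℕ j)))

  -- PG(r-1,q)|G ≅ PG(r-1,q)|H for G,H sets of points (given as predicates
  -- on vectors): a bijection between the point sets of G and H (given on
  -- representatives) preserving independence in both directions.
  RestrIso : (V → Set) → (V → Set) → Set
  RestrIso G H =
    Σ (V → V) (λ φ →
      (∀ u v → G u → G v → SamePoint u v → SamePoint (φ u) (φ v))
      × (∀ u → G u → H (φ u))
      × (∀ u v → G u → G v → SamePoint (φ u) (φ v) → SamePoint u v)
      × (∀ w → H w → Σ V (λ u → G u × SamePoint (φ u) w))
      × (∀ {m} (vs : Fin m → V) → (∀ i → G (vs i)) →
           (LinIndep vs → LinIndep (λ i → φ (vs i)))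
           × (LinIndep (λ i → φ (vs i)) → LinIndep vs)))

-- Choose a basis y₀, …, y_{N-1} of GF(q)^r adapted to the flag (E_i), i.e. such
-- that the first r(E_i) vectors form a basis of E_i for every i; it is built by
-- extending a basis of each flat to one of the next; that the extension stops at
-- exactly r(E_{i+1}) vectors is where the Steinitz exchange lemma enters.  Do the
-- same for (F_i) with z₀, …, z_{N-1}.
-- As r(E_i) = r(F_i), the linear automorphism y_j ↦ z_j maps every E_i onto F_i,
-- hence every E_{i+1} − E_i onto F_{i+1} − F_i and so G_E onto G_F; being linear
-- and invertible, it preserves and reflects independence.
module Submission where

open import Defs
open import Level using (0ℓ)
open import Function using (_∘_)
open import Data.Nat using (ℕ; zero; suc; z≤n; s≤s; _≤_; _<_; _≤?_; _<?_) renaming (_*_ to _*ℕ_)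
open import Data.Nat.Properties
  using ( ≤-refl; ≤-trans; ≤-antisym; ≤-pred; n≤1+n; m≤n⇒m≤1+n; <-irrefl; n≮0; ≰⇒>
        ; m<1+n⇒m<n∨m≡n; m≤n⇒m<n∨m≡n; anyUpTo?)
open import Data.Fin using (Fin; toℕ; fromℕ<) renaming (zero to fzero; suc to fsuc)
import Data.Fin.Properties as Fin
open import Data.Vec using (lookup)
open import Data.Maybe using (nothing)
open import Data.Product using (Σ; _×_; _,_; proj₁; proj₂)
open import Data.Empty using (⊥; ⊥-elim)
open import Data.Sum using ([_,_]′)
open import Relation.Nullary using (¬_; Dec; yes; no)
open import Relation.Nullary.Decidable using (¬?; decidable-stable)
open import Relation.Binary.Bundles using (Setoid)
open import Relation.Binary.PropositionalEquality as ≡ using (_≡_)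
import Relation.Binary.Reasoning.Setoid as SetoidReasoning
open import Tactic.RingSolver.Core.AlmostCommutativeRing using (fromCommutativeRing)

module LinearAlgebra {q : ℕ} (K : FiniteField q) (r : ℕ) where
  open FiniteField K hiding (zero)
  open PG K r
  open import Algebra.Properties.Ring ring using (-‿distribˡ-*)
  open import Algebra.Properties.Group +-group using (x∙y⁻¹≈ε⇒x≈y; x≈y⇒x∙y⁻¹≈ε; inverseʳ-unique; ε⁻¹≈ε)
  open import Algebra.Properties.AbelianGroup +-abelianGroup using (⁻¹-∙-comm)
  open import Tactic.RingSolver.NonReflective (fromCommutativeRing cring (λ _ → nothing))
    using (solve; _⊜_; _⊕_; _⊗_)

  ≈V-refl : ∀ {u} → u ≈V u
  ≈V-refl _ = refl

  ≈V-sym : ∀ {u v} → u ≈V v → v ≈V u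
  ≈V-sym p i = sym (p i)

  ≈V-trans : ∀ {u v w} → u ≈V v → v ≈V w → u ≈V w
  ≈V-trans p p′ i = trans (p i) (p′ i)

  ≈V-reflexive : ∀ {u v} → u ≡ v → u ≈V v
  ≈V-reflexive ≡.refl = ≈V-refl

  ≈V-setoid : Setoid 0ℓ 0ℓ
  ≈V-setoid = record
    { Carrier = V ; _≈_ = _≈V_
    ; isEquivalence = record { refl = ≈V-refl ; sym = ≈V-sym ; trans = ≈V-trans } }

  _≈V?_ : ∀ u v → Dec (u ≈V v)
  u ≈V? v = Fin.all? (λ i → u i ≟F v i)

  +V-cong : ∀ {u u′ v v′} → u ≈V u′ → v ≈V v′ → (u +V v) ≈V (u′ +V v′)
  +V-cong p p′ i = +-cong (p i) (p′ i)

  ·-cong : ∀ {a a′ u u′} → a ≈ a′ → u ≈V u′ → (a · u) ≈V (a′ · u′)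
  ·-cong p p′ i = *-cong p (p′ i)

  negV : V → V
  negV u i = - u i

  1≉0 : ¬ (1# ≈ 0#)
  1≉0 1≈0 = 0≉1 (sym 1≈0)

  ∈P-resp-≈V : ∀ S {u v} → u ≈V v → v ∈P S → u ∈P S
  ∈P-resp-≈V S {u} {v} u≈v = resp S u v (1# , 1≉0 , λ i → trans (u≈v i) (sym (*-identityˡ _)))

  -- Linear combinations

  -- Finite families of vectors and of coefficients are indexed by ℕ;
  -- a family of length m is one whose entries at indices ≥ m are ignored.
  Coeffs : Set
  Coeffs = ℕ → Carrier

  Family : Set
  Family = ℕ → V

  lc : ℕ → Coeffs → Family → V
  lc zero    c b = zeroV
  lc (suc m) c b = (c 0 · b 0) +V lc m (c ∘ suc) (b ∘ suc)

  lc-cong : ∀ m {c c′ b b′} → (∀ j → j < m → c j ≈ c′ j) → (∀ j → j < m → b j ≈V b′ j) →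
            lc m c b ≈V lc m c′ b′
  lc-cong zero    c≈ b≈ = ≈V-refl
  lc-cong (suc m) c≈ b≈ =
    +V-cong (·-cong (c≈ 0 (s≤s z≤n)) (b≈ 0 (s≤s z≤n)))
            (lc-cong m (λ j j<m → c≈ (suc j) (s≤s j<m)) (λ j j<m → b≈ (suc j) (s≤s j<m)))

  lc-zeroCoeffs : ∀ m {c} b → (∀ j → j < m → c j ≈ 0#) → lc m c b ≈V zeroV
  lc-zeroCoeffs zero    b c≈0 = ≈V-refl
  lc-zeroCoeffs (suc m) b c≈0 i =
    trans (+-cong (trans (*-congʳ (c≈0 0 (s≤s z≤n))) (zeroˡ _))
                  (lc-zeroCoeffs m (b ∘ suc) (λ j j<m → c≈0 (suc j) (s≤s j<m)) i))
          (+-identityʳ 0#)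

  lc-+ : ∀ m c d b → lc m (λ j → c j + d j) b ≈V (lc m c b +V lc m d b)
  lc-+ zero    c d b i = sym (+-identityʳ 0#)
  lc-+ (suc m) c d b i =
    trans (+-congˡ (lc-+ m (c ∘ suc) (d ∘ suc) (b ∘ suc) i))
          (solve 5 (λ x y z s t → ((x ⊕ y) ⊗ z ⊕ (s ⊕ t)) ⊜ ((x ⊗ z ⊕ s) ⊕ (y ⊗ z ⊕ t))) refl _ _ _ _ _)

  lc-* : ∀ m a c b → lc m (λ j → a * c j) b ≈V (a · lc m c b)
  lc-* zero    a c b i = sym (zeroʳ a)
  lc-* (suc m) a c b i =
    trans (+-congˡ (lc-* m a (c ∘ suc) (b ∘ suc) i))
          (trans (+-congʳ (*-assoc _ _ _)) (sym (distribˡ _ _ _)))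

  lc-neg : ∀ m c b → lc m (λ j → - c j) b ≈V negV (lc m c b)
  lc-neg zero    c b i = sym ε⁻¹≈ε
  lc-neg (suc m) c b i =
    trans (+-congˡ (lc-neg m (c ∘ suc) (b ∘ suc) i))
          (trans (+-congʳ (sym (-‿distribˡ-* _ _))) (⁻¹-∙-comm _ _))

  lc-+V : ∀ m c u w → lc m c (λ j → u j +V w j) ≈V (lc m c u +V lc m c w)
  lc-+V zero    c u w i = sym (+-identityʳ 0#)
  lc-+V (suc m) c u w i =
    trans (+-congˡ (lc-+V m (c ∘ suc) (u ∘ suc) (w ∘ suc) i))
          (solve 5 (λ x y z s t → (x ⊗ (y ⊕ z) ⊕ (s ⊕ t)) ⊜ ((x ⊗ y ⊕ s) ⊕ (x ⊗ z ⊕ t))) refl _ _ _ _ _)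

  sum : ℕ → Coeffs → Carrier
  sum zero    c = 0#
  sum (suc m) c = c 0 + sum m (c ∘ suc)

  lc-multiples : ∀ m (c μ : Coeffs) w → lc m c (λ j → μ j · w) ≈V (sum m (λ j → c j * μ j) · w)
  lc-multiples zero    c μ w i = sym (zeroˡ _)
  lc-multiples (suc m) c μ w i =
    trans (+-congˡ (lc-multiples m (c ∘ suc) (μ ∘ suc) w i))
          (trans (+-congʳ (sym (*-assoc (c 0) (μ 0) (w i)))) (sym (distribʳ _ _ _)))

  lc-suc : ∀ m c b → lc (suc m) c b ≈V (lc m c b +V (c m · b m))
  lc-suc zero    c b i = +-comm _ _
  lc-suc (suc m) c b i = trans (+-congˡ (lc-suc m (c ∘ suc) (b ∘ suc) i)) (sym (+-assoc _ _ _))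

  lc-zeroTail : ∀ m p c b → m ≤ p → (∀ j → m ≤ j → j < p → c j ≈ 0#) → lc p c b ≈V lc m c b
  lc-zeroTail zero    p       c b _         c≈0 = lc-zeroCoeffs p b (λ j → c≈0 j z≤n)
  lc-zeroTail (suc m) (suc p) c b (s≤s m≤p) c≈0 =
    +V-cong ≈V-refl (lc-zeroTail m p (c ∘ suc) b′ m≤p (λ j m≤j j<p → c≈0 (suc j) (s≤s m≤j) (s≤s j<p)))
    where b′ = b ∘ suc

  lc-dropHead : ∀ m c b → c 0 ≈ 0# → lc (suc m) c b ≈V lc m (c ∘ suc) (b ∘ suc)
  lc-dropHead m c b c₀≈0 i = trans (+-congʳ (trans (*-congʳ c₀≈0) (zeroˡ _))) (+-identityˡ _)

  unit : ℕ → Coeffs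
  unit zero    zero    = 1#
  unit zero    (suc _) = 0#
  unit (suc j) zero    = 0#
  unit (suc j) (suc t) = unit j t

  unit-diag : ∀ j → unit j j ≡ 1#
  unit-diag zero    = ≡.refl
  unit-diag (suc j) = unit-diag j

  lc-unit : ∀ m j b → j < m → lc m (unit j) b ≈V b j
  lc-unit (suc m) zero    b _ i =
    trans (+-cong (*-identityˡ _) (lc-zeroCoeffs m (b ∘ suc) (λ _ _ → refl) i)) (+-identityʳ _)
  lc-unit (suc m) (suc j) b (s≤s j<m) i =
    trans (+-cong (zeroˡ _) (lc-unit m j (b ∘ suc) j<m i)) (+-identityˡ _)

  skip : ℕ → ℕ → ℕ
  skip zero    t       = suc t
  skip (suc j) zero    = zero
  skip (suc j) (suc t) = suc (skip j t)

  skip-≤ : ∀ j t → skip j t ≤ suc t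
  skip-≤ zero    t       = ≤-refl
  skip-≤ (suc j) zero    = z≤n
  skip-≤ (suc j) (suc t) = s≤s (skip-≤ j t)

  lc-skip : ∀ n j c b → j ≤ n → lc (suc n) c b ≈V ((c j · b j) +V lc n (c ∘ skip j) (b ∘ skip j))
  lc-skip n       zero    c b _         = ≈V-refl
  lc-skip (suc n) (suc j) c b (s≤s j≤n) i =
    trans (+-congˡ (lc-skip n j (c ∘ suc) (b ∘ suc) j≤n i))
          (solve 3 (λ x y z → (x ⊕ (y ⊕ z)) ⊜ (y ⊕ (x ⊕ z))) refl _ _ _)

  insert : ℕ → Carrier → Coeffs → Coeffs
  insert zero    x d zero    = x
  insert zero    x d (suc t) = d t
  insert (suc j) x d zero    = d zero
  insert (suc j) x d (suc t) = insert j x (d ∘ suc) t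

  insert-skip : ∀ j x d t → insert j x d (skip j t) ≡ d t
  insert-skip zero    x d t       = ≡.refl
  insert-skip (suc j) x d zero    = ≡.refl
  insert-skip (suc j) x d (suc t) = insert-skip j x (d ∘ suc) t

  insert-diag : ∀ j x d → insert j x d j ≡ x
  insert-diag zero    x d = ≡.refl
  insert-diag (suc j) x d = insert-diag j x (d ∘ suc)

  -- Span and independence

  InSpan : Family → ℕ → V → Set
  InSpan b m v = Σ Coeffs (λ c → lc m c b ≈V v)

  Independent : Family → ℕ → Set
  Independent b m = ∀ c → lc m c b ≈V zeroV → ∀ j → j < m → c j ≈ 0#

  _◂_ : Carrier → Coeffs → Coeffs
  (x ◂ c) zero    = x
  (x ◂ c) (suc j) = c j

  PrefixInvariant : ℕ → (Coeffs → Set) → Set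
  PrefixInvariant m P = ∀ {c c′} → (∀ j → j < m → c j ≈ c′ j) → P c → P c′

  -- GF(q) is finite, so a property of the first m coefficients is decided
  -- by trying all q^m of them.
  coeffs? : ∀ m {P : Coeffs → Set} → (∀ c → Dec (P c)) → PrefixInvariant m P → Dec (Σ Coeffs P)
  coeffs? zero {P} P? inv with P? (λ _ → 0#)
  ... | yes p = yes (_ , p)
  ... | no ¬p = no λ (c , p) → ¬p (inv (λ _ ()) p)
  coeffs? (suc m) {P} P? inv
    with Fin.any? (λ i → coeffs? m (λ c → P? (lookup elems i ◂ c)) (λ c≈ → inv (◂-cong c≈)))
    where
    ◂-cong : ∀ {x c c′} → (∀ j → j < m → c j ≈ c′ j) → ∀ j → j < suc m → (x ◂ c) j ≈ (x ◂ c′) j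
    ◂-cong c≈ zero    _         = refl
    ◂-cong c≈ (suc j) (s≤s j<m) = c≈ j j<m
  ... | yes (_ , _ , p) = yes (_ , p)
  ... | no ¬p = no λ (c , p) →
    let (i , c₀≈) = elems-complete (c 0)
    in ¬p (i , c ∘ suc , inv (λ { zero _ → c₀≈ ; (suc j) _ → refl }) p)

  InSpan? : ∀ b m v → Dec (InSpan b m v)
  InSpan? b m v = coeffs? m (λ c → lc m c b ≈V? v)
    (λ c≈ lc≈v → ≈V-trans (lc-cong m (λ j j<m → sym (c≈ j j<m)) (λ _ _ → ≈V-refl)) lc≈v)

  independent⇒coeffs-unique : ∀ {b m} → Independent b m → ∀ c c′ → lc m c b ≈V lc m c′ b →
                              ∀ j → j < m → c j ≈ c′ j
  independent⇒coeffs-unique {b} {m} ind c c′ lc≈ j j<m =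
    x∙y⁻¹≈ε⇒x≈y _ _ (ind (λ j → c j - c′ j) difference≈0 j j<m)
    where
    difference≈0 : lc m (λ j → c j - c′ j) b ≈V zeroV
    difference≈0 i = trans (lc-+ m c (λ j → - c′ j) b i)
                           (trans (+-congˡ (lc-neg m c′ b i)) (x≈y⇒x∙y⁻¹≈ε (lc≈ i)))

  independent⇒nonzero : ∀ {b m j} → Independent b m → j < m → NonZero (b j)
  independent⇒nonzero {b} {m} {j} ind j<m b≈0 =
    0≉1 (trans (sym (ind (unit j) (≈V-trans (lc-unit m j b j<m) b≈0) j j<m)) (reflexive (unit-diag j)))

  -- Steinitz exchange

  -- One step of Gaussian elimination: with the pivot γ = C j₀ 0 ≉ 0, subtract
  -- μ t = C (skip j₀ t) 0 / γ times a j₀ from the other vectors, which kills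
  -- their coefficient at b 0.
  module Elimination (a b : Family) (C : ℕ → Coeffs) (j₀ : ℕ) (γ⁻¹ : Carrier)
                     (γγ⁻¹≈1 : C j₀ 0 * γ⁻¹ ≈ 1#) where

    μ : ℕ → Carrier
    μ t = C (skip j₀ t) 0 * γ⁻¹

    a′ : Family
    a′ t = a (skip j₀ t) +V ((- μ t) · a j₀)

    C′ : ℕ → Coeffs
    C′ t u = C (skip j₀ t) (suc u) + (- μ t) * C j₀ (suc u)

    μγ≈ : ∀ t → μ t * C j₀ 0 ≈ C (skip j₀ t) 0
    μγ≈ t = trans (*-assoc _ _ _) (trans (*-congˡ (trans (*-comm _ _) γγ⁻¹≈1)) (*-identityʳ _))

    skip-< : ∀ {n t} → t < n → skip j₀ t < suc n
    skip-< {t = t} t<n = s≤s (≤-trans (skip-≤ j₀ t) t<n)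

    a′-in-span : ∀ m n → (∀ j → j < suc n → lc (suc m) (C j) b ≈V a j) →
                 j₀ < suc n → ∀ t → t < n → lc m (C′ t) (b ∘ suc) ≈V a′ t
    a′-in-span m n a≈ j₀<n t t<n i = begin
      lc m (C′ t) b′ i
                                  ≈⟨ lc-+ m (Cₜ ∘ suc) (λ u → - μ t * C j₀ (suc u)) b′ i ⟩
      lc m (Cₜ ∘ suc) b′ i + lc m (λ u → - μ t * C j₀ (suc u)) b′ i
                                                        ≈⟨ +-congˡ (lc-* m (- μ t) (C j₀ ∘ suc) b′ i) ⟩
      R + - μ t * R₀                                    ≈⟨ cancel ⟨
      (Cₜ 0 * b 0 i + R) + - μ t * (C j₀ 0 * b 0 i + R₀)
                                  ≈⟨ +-cong (a≈ (skip j₀ t) (skip-< t<n) i) (*-congˡ (a≈ j₀ j₀<n i)) ⟩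
      a′ t i                                            ∎
      where
      open SetoidReasoning setoid
      b′ = b ∘ suc
      Cₜ = C (skip j₀ t)
      R  = lc m (Cₜ ∘ suc) b′ i
      R₀ = lc m (C j₀ ∘ suc) b′ i
      interchange : ∀ x y z w → (x + y) + (z + w) ≈ (x + z) + (y + w)
      interchange = solve 4 (λ x y z w → ((x ⊕ y) ⊕ (z ⊕ w)) ⊜ ((x ⊕ z) ⊕ (y ⊕ w))) refl
      pivot-term : - μ t * (C j₀ 0 * b 0 i) ≈ - (Cₜ 0 * b 0 i)
      pivot-term = trans (sym (-‿distribˡ-* _ _))
                         (-‿cong (trans (sym (*-assoc _ _ _)) (*-congʳ (μγ≈ t))))
      cancel : (Cₜ 0 * b 0 i + R) + - μ t * (C j₀ 0 * b 0 i + R₀) ≈ R + - μ t * R₀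
      cancel = begin
        (Cₜ 0 * b 0 i + R) + - μ t * (C j₀ 0 * b 0 i + R₀)        ≈⟨ +-congˡ (distribˡ _ _ _) ⟩
        (Cₜ 0 * b 0 i + R) + (- μ t * (C j₀ 0 * b 0 i) + - μ t * R₀) ≈⟨ interchange _ _ _ _ ⟩
        (Cₜ 0 * b 0 i + - μ t * (C j₀ 0 * b 0 i)) + (R + - μ t * R₀)
                                            ≈⟨ +-congʳ (trans (+-congˡ pivot-term) (-‿inverseʳ _)) ⟩
        0# + (R + - μ t * R₀)                                       ≈⟨ +-identityˡ _ ⟩
        R + - μ t * R₀                                              ∎

    -- A relation Σ d t · a′ t = 0 is the relation among the a with coefficient
    -- d t at skip j₀ t and s = Σ d t · (- μ t) at j₀.
    a′-independent : ∀ n → j₀ < suc n → Independent a (suc n) → Independent a′ n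
    a′-independent n (s≤s j₀≤n) ind d lc≈0 t t<n =
      trans (sym (reflexive (insert-skip j₀ s d t))) (ind (insert j₀ s d) lc≈0′ (skip j₀ t) (skip-< t<n))
      where
      s = sum n (λ t → d t * - μ t)
      e = insert j₀ s d
      lc≈0′ : lc (suc n) e a ≈V zeroV
      lc≈0′ = begin
        lc (suc n) e a                                     ≈⟨ lc-skip n j₀ e a j₀≤n ⟩
        (e j₀ · a j₀) +V lc n (e ∘ skip j₀) (a ∘ skip j₀)
            ≈⟨ +V-cong (·-cong (reflexive (insert-diag j₀ s d)) ≈V-refl)
                       (lc-cong n (λ u _ → reflexive (insert-skip j₀ s d u)) (λ _ _ → ≈V-refl)) ⟩
        (s · a j₀) +V lc n d (a ∘ skip j₀)                 ≈⟨ (λ i → +-comm _ _) ⟩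
        lc n d (a ∘ skip j₀) +V (s · a j₀)
            ≈⟨ +V-cong ≈V-refl (lc-multiples n d (λ t → - μ t) (a j₀)) ⟨
        lc n d (a ∘ skip j₀) +V lc n d (λ t → (- μ t) · a j₀)
            ≈⟨ lc-+V n d (a ∘ skip j₀) (λ t → (- μ t) · a j₀) ⟨
        lc n d a′                                          ≈⟨ lc≈0 ⟩
        zeroV                                              ∎
        where open SetoidReasoning ≈V-setoid

  exchange : ∀ m n (a b : Family) (C : ℕ → Coeffs) → Independent a n →
             (∀ j → j < n → lc m (C j) b ≈V a j) → n ≤ m
  exchange m       zero    a b C ind a≈ = z≤n
  exchange zero    (suc n) a b C ind a≈ =
    ⊥-elim (independent⇒nonzero {b = a} ind (s≤s z≤n) (≈V-sym (a≈ 0 (s≤s z≤n))))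
  exchange (suc m) (suc n) a b C ind a≈ with anyUpTo? (λ j → ¬? (C j 0 ≟F 0#)) (suc n)
  ... | yes (j₀ , j₀<n , γ≉0) =
    s≤s (exchange m n a′ (b ∘ suc) C′ (a′-independent n j₀<n ind) (a′-in-span m n a≈ j₀<n))
    where open Elimination a b C j₀ (proj₁ (inverse _ γ≉0)) (proj₂ (inverse _ γ≉0))
  ... | no noPivot = m≤n⇒m≤1+n (exchange m (suc n) a (b ∘ suc) (λ j → C j ∘ suc) ind a≈′)
    where
    a≈′ : ∀ j → j < suc n → lc m (C j ∘ suc) (b ∘ suc) ≈V a j
    a≈′ j j<n = ≈V-trans (≈V-sym (lc-dropHead m (C j) b C₀≈0)) (a≈ j j<n)
      where C₀≈0 = decidable-stable (C j 0 ≟F 0#) (λ C₀≉0 → noPivot (j , j<n , C₀≉0))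

  independent-in-span⇒≤ : ∀ {a b n m} → Independent a n → (∀ j → j < n → InSpan b m (a j)) → n ≤ m
  independent-in-span⇒≤ {a} {b} {n} {m} ind spans = exchange m n a b C ind C-spec
    where
    C : ℕ → Coeffs
    C j with j <? n
    ... | yes j<n = proj₁ (spans j j<n)
    ... | no  _   = λ _ → 0#
    C-spec : ∀ j → j < n → lc m (C j) b ≈V a j
    C-spec j j<n with j <? n
    ... | yes j<n′ = proj₂ (spans j j<n′)
    ... | no  j≮n  = ⊥-elim (j≮n j<n)

  -- Bases of point sets of given rank

  truncate : ℕ → Coeffs → Coeffs
  truncate zero    c j       = 0#
  truncate (suc m) c zero    = c zero
  truncate (suc m) c (suc j) = truncate m (c ∘ suc) j

  truncate-< : ∀ m c j → j < m → truncate m c j ≡ c j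
  truncate-< (suc m) c zero    _         = ≡.refl
  truncate-< (suc m) c (suc j) (s≤s j<m) = truncate-< m (c ∘ suc) j j<m

  truncate-≥ : ∀ m c j → m ≤ j → truncate m c j ≡ 0#
  truncate-≥ zero    c j       _         = ≡.refl
  truncate-≥ (suc m) c (suc j) (s≤s m≤j) = truncate-≥ m (c ∘ suc) j m≤j

  lc-truncate : ∀ m p c b → m ≤ p → lc p (truncate m c) b ≈V lc m c b
  lc-truncate m p c b m≤p =
    ≈V-trans (lc-zeroTail m p (truncate m c) b m≤p (λ j m≤j _ → reflexive (truncate-≥ m c j m≤j)))
             (lc-cong m (λ j j<m → reflexive (truncate-< m c j j<m)) (λ _ _ → ≈V-refl))

  InSpan-mono : ∀ {b b′ m p v} → m ≤ p → (∀ j → j < m → b′ j ≡ b j) → InSpan b m v → InSpan b′ p v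
  InSpan-mono {b} {b′} {m} {p} m≤p b′≡b (c , lc≈v) =
    truncate m c ,
    ≈V-trans (lc-truncate m p c b′ m≤p)
             (≈V-trans (lc-cong m (λ _ _ → refl) (λ j j<m → ≈V-reflexive (b′≡b j j<m))) lc≈v)

  _[_]≔_ : Family → ℕ → V → Family
  (b [ zero  ]≔ v) zero    = v
  (b [ zero  ]≔ v) (suc j) = b (suc j)
  (b [ suc p ]≔ v) zero    = b zero
  (b [ suc p ]≔ v) (suc j) = ((b ∘ suc) [ p ]≔ v) j

  []≔-< : ∀ b {p} v {j} → j < p → (b [ p ]≔ v) j ≡ b j
  []≔-< b {suc p} v {zero}  _         = ≡.refl
  []≔-< b {suc p} v {suc j} (s≤s j<p) = []≔-< (b ∘ suc) v j<p

  []≔-≡ : ∀ b p v → (b [ p ]≔ v) p ≡ v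
  []≔-≡ b zero    v = ≡.refl
  []≔-≡ b (suc p) v = []≔-≡ (b ∘ suc) p v

  independent-snoc : ∀ {b p v} → Independent b p → ¬ InSpan b p v → Independent (b [ p ]≔ v) (suc p)
  independent-snoc {b} {p} {v} ind v∉ c lc≈0 j j<p+1 =
    [ ind c lc≈0′ j , (λ { ≡.refl → cₚ≈0 }) ]′ (m<1+n⇒m<n∨m≡n j<p+1)
    where
    b′ = b [ p ]≔ v
    split : (lc p c b +V (c p · v)) ≈V zeroV
    split = ≈V-trans (+V-cong (lc-cong p (λ _ _ → refl) (λ j j<p → ≈V-reflexive (≡.sym ([]≔-< b v j<p))))
                              (·-cong refl (≈V-reflexive (≡.sym ([]≔-≡ b p v)))))
                     (≈V-trans (≈V-sym (lc-suc p c b′)) lc≈0)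
    cₚ≈0 : c p ≈ 0#
    cₚ≈0 = decidable-stable (c p ≟F 0#) (λ cₚ≉0 → v∉ (solve-for-v (inverse (c p) cₚ≉0)))
      where
      solve-for-v : Σ Carrier (λ e → c p * e ≈ 1#) → InSpan b p v
      solve-for-v (e , cₚe≈1) = (λ j → e * - c j) , λ i →
        trans (lc-* p e (λ j → - c j) b i)
        (trans (*-congˡ (lc-neg p c b i))
        (trans (*-congˡ (sym (inverseʳ-unique _ _ (split i))))
        (trans (sym (*-assoc _ _ _)) (trans (*-congʳ (trans (*-comm _ _) cₚe≈1)) (*-identityˡ _)))))
    lc≈0′ : lc p c b ≈V zeroV
    lc≈0′ i = trans (sym (+-identityʳ _))
                    (trans (+-congˡ (sym (trans (*-congʳ cₚ≈0) (zeroˡ _)))) (split i))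

  fromFin : ∀ {n} {A : Set} → A → (Fin n → A) → ℕ → A
  fromFin {zero}  d f j       = d
  fromFin {suc n} d f zero    = f fzero
  fromFin {suc n} d f (suc j) = fromFin d (f ∘ fsuc) j

  fromFin-toℕ : ∀ {n} {A : Set} (d : A) (f : Fin n → A) i → fromFin d f (toℕ i) ≡ f i
  fromFin-toℕ d f fzero    = ≡.refl
  fromFin-toℕ d f (fsuc i) = fromFin-toℕ d (f ∘ fsuc) i

  fromFin-≥ : ∀ {n} {A : Set} (d : A) (f : Fin n → A) j → n ≤ j → fromFin d f j ≡ d
  fromFin-≥ {zero}  d f j       _         = ≡.refl
  fromFin-≥ {suc n} d f (suc j) (s≤s n≤j) = fromFin-≥ d (f ∘ fsuc) j n≤j

  lincomb-cong : ∀ {m} {c c′ : Fin m → Carrier} {vs vs′ : Fin m → V} →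
                 (∀ i → c i ≈ c′ i) → (∀ i → vs i ≈V vs′ i) → lincomb c vs ≈V lincomb c′ vs′
  lincomb-cong {zero}  c≈ vs≈ = ≈V-refl
  lincomb-cong {suc m} c≈ vs≈ =
    +V-cong (·-cong (c≈ fzero) (vs≈ fzero)) (lincomb-cong (c≈ ∘ fsuc) (vs≈ ∘ fsuc))

  lc≈lincomb : ∀ m (c : Coeffs) (b : Family) → lc m c b ≈V lincomb {m} (c ∘ toℕ) (b ∘ toℕ)
  lc≈lincomb zero    c b = ≈V-refl
  lc≈lincomb (suc m) c b = +V-cong ≈V-refl (lc≈lincomb m (c ∘ suc) (b ∘ suc))

  LinIndep⇒Independent : ∀ {n} (vs : Fin n → V) → LinIndep vs → Independent (fromFin zeroV vs) n
  LinIndep⇒Independent {n} vs li c lc≈0 j j<n =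
    ≡.subst (λ k → c k ≈ 0#) (Fin.toℕ-fromℕ< j<n) (li (c ∘ toℕ) lincomb≈0 (fromℕ< j<n))
    where
    lincomb≈0 : lincomb (c ∘ toℕ) vs ≈V zeroV
    lincomb≈0 = ≈V-trans (lincomb-cong (λ _ → refl)
                                       (λ i → ≈V-reflexive (≡.sym (fromFin-toℕ zeroV vs i))))
                         (≈V-trans (≈V-sym (lc≈lincomb n c (fromFin zeroV vs))) lc≈0)

  Independent⇒LinIndep : ∀ {b n p} → n ≤ p → Independent b p → LinIndep {n} (b ∘ toℕ)
  Independent⇒LinIndep {b} {n} {p} n≤p ind c lincomb≈0 i =
    ≡.subst (_≈ 0#) (fromFin-toℕ 0# c i) (ind c′ lc≈0 (toℕ i) (≤-trans (Fin.toℕ<n i) n≤p))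
    where
    c′ = fromFin 0# c
    lc≈0 : lc p c′ b ≈V zeroV
    lc≈0 = ≈V-trans (lc-zeroTail n p c′ b n≤p (λ j n≤j _ → reflexive (fromFin-≥ 0# c j n≤j)))
           (≈V-trans (lc≈lincomb n c′ b)
           (≈V-trans (lincomb-cong (λ i → reflexive (fromFin-toℕ 0# c i)) (λ _ → ≈V-refl)) lincomb≈0))

  record IndependentIn (S : PointSet) (b : Family) (m : ℕ) : Set where
    field
      independent : Independent b m
      members     : ∀ j → j < m → b j ∈P S
  open IndependentIn public

  HasRank⇒IndependentIn : ∀ {S n} → HasRank S n → Σ Family (λ a → IndependentIn S a n)
  HasRank⇒IndependentIn {S} ((vs , vs∈S , li) , _) = fromFin zeroV vs , record
    { independent = LinIndep⇒Independent vs li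
    ; members     = λ j j<n →
        ≡.subst (λ k → fromFin zeroV vs k ∈P S) (Fin.toℕ-fromℕ< j<n)
                (≡.subst (_∈P S) (≡.sym (fromFin-toℕ zeroV vs (fromℕ< j<n))) (vs∈S (fromℕ< j<n)))
    }

  IndependentIn⇒≤rank : ∀ {S n b p} → HasRank S n → IndependentIn S b p → p ≤ n
  IndependentIn⇒≤rank {n = n} {p = p} (_ , noLarger) b-ind with p ≤? n
  ... | yes p≤n = p≤n
  ... | no  p≰n = ⊥-elim (noLarger _ (λ i → members b-ind (toℕ i) (≤-trans (Fin.toℕ<n i) (≰⇒> p≰n)))
                                    (Independent⇒LinIndep (≰⇒> p≰n) (independent b-ind)))

  IndependentIn-snoc : ∀ {S b p v} → IndependentIn S b p → v ∈P S → ¬ InSpan b p v →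
                       IndependentIn S (b [ p ]≔ v) (suc p)
  IndependentIn-snoc {S} {b} {p} {v} b-ind v∈S v∉ = record
    { independent = independent-snoc (independent b-ind) v∉
    ; members     = λ j j<p+1 →
        [ (λ j<p → ≡.subst (_∈P S) (≡.sym ([]≔-< b v j<p)) (members b-ind j j<p))
        , (λ { ≡.refl → ≡.subst (_∈P S) (≡.sym ([]≔-≡ b p v)) v∈S }) ]′ (m<1+n⇒m<n∨m≡n j<p+1)
    }

  IndependentIn-rank⇒spans : ∀ {S n b v} → HasRank S n → IndependentIn S b n → v ∈P S → InSpan b n v
  IndependentIn-rank⇒spans {n = n} {b} {v} hr b-ind v∈S with InSpan? b n v
  ... | yes v∈ = v∈
  ... | no  v∉ =
    ⊥-elim (<-irrefl {n} ≡.refl (IndependentIn⇒≤rank hr (IndependentIn-snoc b-ind v∈S v∉)))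

  record Extension (S : PointSet) (x : Family) (m : ℕ) (a : Family) (t : ℕ) : Set where
    field
      family        : Family
      size          : ℕ
      extends       : ∀ j → j < m → family j ≡ x j
      m≤size        : m ≤ size
      independentIn : IndependentIn S family size
      spans         : ∀ s → s < t → InSpan family size (a s)
  open Extension public

  -- Greedily append those a s that are not yet in the span.
  extend-to-span : ∀ {S x m a} t → IndependentIn S x m → (∀ s → s < t → a s ∈P S) → Extension S x m a t
  extend-to-span {x = x} {m} zero x-ind _ = record
    { family = x ; size = m ; extends = λ _ _ → ≡.refl ; m≤size = ≤-refl
    ; independentIn = x-ind ; spans = λ _ () }
  extend-to-span {a = a} (suc t) x-ind a∈S
    with extend-to-span t x-ind (λ s s<t → a∈S s (m≤n⇒m≤1+n s<t))
  ... | e with InSpan? (family e) (size e) (a t)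
  ... | yes aₜ∈ = record
    { family = family e ; size = size e ; extends = extends e ; m≤size = m≤size e
    ; independentIn = independentIn e
    ; spans = λ s s<t+1 → [ spans e s , (λ { ≡.refl → aₜ∈ }) ]′ (m<1+n⇒m<n∨m≡n s<t+1) }
  ... | no  aₜ∉ = record
    { family        = y [ p ]≔ a t
    ; size          = suc p
    ; extends       = λ j j<m → ≡.trans ([]≔-< y (a t) (≤-trans j<m (m≤size e))) (extends e j j<m)
    ; m≤size        = m≤n⇒m≤1+n (m≤size e)
    ; independentIn = IndependentIn-snoc (independentIn e) (a∈S t ≤-refl) aₜ∉
    ; spans         = λ s s<t+1 →
        [ (λ s<t → InSpan-mono (n≤1+n p) (λ j j<p → []≔-< y (a t) j<p) (spans e s s<t))
        , (λ { ≡.refl → unit p , ≈V-trans (lc-unit (suc p) p (y [ p ]≔ a t) ≤-refl)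
                                          (≈V-reflexive ([]≔-≡ y p (a t))) }) ]′ (m<1+n⇒m<n∨m≡n s<t+1)
    }
    where
    y = family e
    p = size e

  extend-to-basis : ∀ {S n x m} → HasRank S n → IndependentIn S x m →
                    Σ Family λ y → (∀ j → j < m → y j ≡ x j) × m ≤ n × IndependentIn S y n
                                   × (∀ v → v ∈P S → InSpan y n v)
  extend-to-basis {S} hr x-ind with HasRank⇒IndependentIn {S} hr
  ... | a , a-ind with extend-to-span _ x-ind (members a-ind)
  ... | e with ≤-antisym (IndependentIn⇒≤rank hr (independentIn e))
                         (independent-in-span⇒≤ (independent a-ind) (spans e))
  ... | ≡.refl = family e , extends e , m≤size e , independentIn e ,
                 λ v v∈S → IndependentIn-rank⇒spans hr (independentIn e) v∈S

  flat-closed : ∀ {S} → IsFlat S → ∀ m c b → (∀ j → j < m → b j ∈P S) → NonZero (lc m c b) →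
                lc m c b ∈P S
  flat-closed S-flat zero    c b _   nz = ⊥-elim (nz ≈V-refl)
  flat-closed {S} S-flat (suc m) c b b∈S nz with lc m (c ∘ suc) (b ∘ suc) ≈V? zeroV
  ... | yes R≈0 = ∈P-resp-≈V S lc≈ (S-flat _ _ (c 0) 0# b₀∈S b₀∈S (nz ∘ ≈V-trans lc≈))
    where
    b₀∈S = b∈S 0 (s≤s z≤n)
    lc≈ : lc (suc m) c b ≈V ((c 0 · b 0) +V (0# · b 0))
    lc≈ i = +-congˡ (trans (R≈0 i) (sym (zeroˡ _)))
  ... | no  R≉0 = ∈P-resp-≈V S lc≈ (S-flat _ _ (c 0) 1# (b∈S 0 (s≤s z≤n)) R∈S (nz ∘ ≈V-trans lc≈))
    where
    R∈S = flat-closed {S} S-flat m (c ∘ suc) (b ∘ suc) (λ j j<m → b∈S (suc j) (s≤s j<m)) R≉0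
    lc≈ : lc (suc m) c b ≈V ((c 0 · b 0) +V (1# · lc m (c ∘ suc) (b ∘ suc)))
    lc≈ i = +-congˡ (sym (*-identityˡ _))

  -- Linear maps

  record IsLinear (f : V → V) : Set where
    field
      cong  : ∀ {u v} → u ≈V v → f u ≈V f v
      +-hom : ∀ u v → f (u +V v) ≈V (f u +V f v)
      ·-hom : ∀ a v → f (a · v) ≈V (a · f v)

  module _ {f : V → V} (f-linear : IsLinear f) where
    open IsLinear f-linear

    linear-zero : f zeroV ≈V zeroV
    linear-zero = ≈V-trans (cong (λ _ → sym (zeroˡ 0#))) (≈V-trans (·-hom 0# zeroV) (λ i → zeroˡ _))

    linear-lincomb : ∀ {m} (c : Fin m → Carrier) vs → f (lincomb c vs) ≈V lincomb c (f ∘ vs)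
    linear-lincomb {zero}  c vs = linear-zero
    linear-lincomb {suc m} c vs =
      ≈V-trans (+-hom _ _) (+V-cong (·-hom _ _) (linear-lincomb (c ∘ fsuc) (vs ∘ fsuc)))

  linear-bijection⇒RestrIso : ∀ {G H : V → Set} (f g : V → V) → IsLinear f → IsLinear g →
                              (∀ v → g (f v) ≈V v) → (∀ w → f (g w) ≈V w) →
                              (∀ v → G v → H (f v)) → (∀ w → H w → G (g w)) → RestrIso G H
  linear-bijection⇒RestrIso {G} {H} f g f-lin g-lin gf≈ fg≈ G⇒H H⇒G =
    f , (λ _ _ _ _ → f-samePoint) , G⇒H , (λ _ _ _ _ → reflect) , onto ,
    (λ vs _ → preserves vs , reflects vs)
    where
    module f = IsLinear f-lin
    module g = IsLinear g-lin
    f-samePoint : ∀ {u v} → SamePoint u v → SamePoint (f u) (f v)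
    f-samePoint (c , c≉0 , u≈cv) = c , c≉0 , ≈V-trans (f.cong u≈cv) (f.·-hom c _)
    reflect : ∀ {u v} → SamePoint (f u) (f v) → SamePoint u v
    reflect {u} {v} (c , c≉0 , fu≈cfv) =
      c , c≉0 , ≈V-trans (≈V-sym (gf≈ u))
                         (≈V-trans (g.cong fu≈cfv) (≈V-trans (g.·-hom c _) (·-cong refl (gf≈ v))))
    onto : ∀ w → H w → Σ V (λ u → G u × SamePoint (f u) w)
    onto w Hw = g w , H⇒G w Hw , 1# , 1≉0 , λ i → trans (fg≈ w i) (sym (*-identityˡ _))
    preserves : ∀ {m} (vs : Fin m → V) → LinIndep vs → LinIndep (f ∘ vs)
    preserves vs li c lc≈0 = li c (≈V-trans (≈V-sym (gf≈ _))
      (≈V-trans (g.cong (≈V-trans (linear-lincomb f-lin c vs) lc≈0)) (linear-zero g-lin)))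
    reflects : ∀ {m} (vs : Fin m → V) → LinIndep (f ∘ vs) → LinIndep vs
    reflects vs li c lc≈0 = li c (≈V-trans (≈V-sym (linear-lincomb f-lin c vs))
      (≈V-trans (f.cong lc≈0) (linear-zero f-lin)))

  module ChangeOfBasis (N : ℕ) (Y Z : Family) (Y-ind : Independent Y N) (Y-spans : ∀ v → InSpan Y N v)
                       (Z-ind : Independent Z N) where

    coords : V → Coeffs
    coords v = proj₁ (Y-spans v)

    coords-spec : ∀ v → lc N (coords v) Y ≈V v
    coords-spec v = proj₂ (Y-spans v)

    map : V → V
    map v = lc N (coords v) Z

    map-lc : ∀ {c v} → lc N c Y ≈V v → map v ≈V lc N c Z
    map-lc {c} {v} lc≈v =
      lc-cong N (independent⇒coeffs-unique Y-ind (coords v) c (≈V-trans (coords-spec v) (≈V-sym lc≈v)))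
                (λ _ _ → ≈V-refl)

    map-linear : IsLinear map
    map-linear = record
      { cong  = λ {u} u≈v → ≈V-sym (map-lc (≈V-trans (coords-spec u) u≈v))
      ; +-hom = λ u v → ≈V-trans (map-lc (≈V-trans (lc-+ N (coords u) (coords v) Y)
                                                   (+V-cong (coords-spec u) (coords-spec v))))
                                 (lc-+ N (coords u) (coords v) Z)
      ; ·-hom = λ a v → ≈V-trans (map-lc (≈V-trans (lc-* N a (coords v) Y) (·-cong refl (coords-spec v))))
                                 (lc-* N a (coords v) Z)
      }

    map-nonzero : ∀ {v} → NonZero v → NonZero (map v)
    map-nonzero {v} v≉0 mapv≈0 =
      v≉0 (≈V-trans (≈V-sym (coords-spec v)) (lc-zeroCoeffs N Y (Z-ind (coords v) mapv≈0)))

bounded-choice : ∀ {k} {P : ℕ → ℕ → Set} → (∀ i → i ≤ k → Σ ℕ (P i)) →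
                 Σ (ℕ → ℕ) (λ n → ∀ i → i ≤ k → P i (n i))
bounded-choice {k} {P} choices = n , n-spec
  where
  n : ℕ → ℕ
  n i with i ≤? k
  ... | yes i≤k = proj₁ (choices i i≤k)
  ... | no  _   = 0
  n-spec : ∀ i → i ≤ k → P i (n i)
  n-spec i i≤k with i ≤? k
  ... | yes i≤k′ = proj₂ (choices i i≤k′)
  ... | no  i≰k  = ⊥-elim (i≰k i≤k)

module Flags {q : ℕ} (K : FiniteField q) (r : ℕ) where
  open FiniteField K hiding (zero)
  open PG K r
  open LinearAlgebra K r

  record AdaptedBasis (t : ℕ) (n : ℕ → ℕ) (S : ℕ → PointSet) : Set where
    field
      basis             : Family
      basis-independent : Independent basis (n t)
      rank≤top          : ∀ i → i ≤ t → n i ≤ n t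
      level-members     : ∀ i → i ≤ t → ∀ j → j < n i → basis j ∈P S i
      level-spans       : ∀ i → i ≤ t → ∀ v → v ∈P S i → InSpan basis (n i) v
  open AdaptedBasis public

  rank-empty : ∀ {S n} → IsEmpty S → HasRank S n → n ≡ 0
  rank-empty {n = zero}  _       _                  = ≡.refl
  rank-empty {n = suc n} S-empty ((vs , vs∈S , _) , _) = ⊥-elim (S-empty (vs fzero) (vs∈S fzero))

  adapted-basis : ∀ {k n S} → NestedFlats k S → (∀ i → i ≤ k → HasRank (S i) (n i)) →
                  ∀ t → t ≤ k → AdaptedBasis t n S
  adapted-basis {n = n} {S} (S₀-empty , _) ranks zero _ = record
    { basis             = λ _ → zeroV
    ; basis-independent = λ _ _ j j<n₀ → ⊥-elim (below-n₀ j<n₀)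
    ; rank≤top          = λ { zero z≤n → ≤-refl }
    ; level-members     = λ { zero z≤n j j<n₀ → ⊥-elim (below-n₀ j<n₀) }
    ; level-spans       = λ { zero z≤n v v∈S₀ → ⊥-elim (S₀-empty v v∈S₀) }
    }
    where
    below-n₀ : ∀ {j} → j < n 0 → ⊥
    below-n₀ j<n₀ = n≮0 (≡.subst (_ <_) (rank-empty {S 0} S₀-empty (ranks 0 z≤n)) j<n₀)
  adapted-basis {k} {n} {S} flag@(_ , _ , _ , S⊆S) ranks (suc t) t<k
    with adapted-basis {k} {n} {S} flag ranks t (≤-trans (n≤1+n t) t<k)
  ... | B with extend-to-basis {S (suc t)} (ranks (suc t) t<k) (record
                 { independent = basis-independent B
                 ; members     = λ j j<nₜ → S⊆S t t<k _ (level-members B t ≤-refl j j<nₜ) })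
  ... | y , y≡ , nₜ≤ , y-indep , y-spans = record
    { basis             = y
    ; basis-independent = independent y-indep
    ; rank≤top          = λ i i≤t+1 → by-level {P = λ i → n i ≤ n (suc t)} i≤t+1
        (λ i≤t → ≤-trans (rank≤top B i i≤t) nₜ≤)
        ≤-refl
    ; level-members     = λ i i≤t+1 → by-level {P = λ i → ∀ j → j < n i → y j ∈P S i} i≤t+1
        (λ i≤t j j<nᵢ → ≡.subst (_∈P S i) (≡.sym (y≡ j (≤-trans j<nᵢ (rank≤top B i i≤t))))
                                (level-members B i i≤t j j<nᵢ))
        (members y-indep)
    ; level-spans       = λ i i≤t+1 → by-level {P = λ i → ∀ v → v ∈P S i → InSpan y (n i) v} i≤t+1
        (λ i≤t v v∈S → InSpan-mono ≤-refl (λ j j<nᵢ → y≡ j (≤-trans j<nᵢ (rank≤top B i i≤t)))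
                                   (level-spans B i i≤t v v∈S))
        y-spans
    }
    where
    by-level : ∀ {i} {P : ℕ → Set} → i ≤ suc t → (i ≤ t → P i) → P (suc t) → P i
    by-level i≤t+1 below top = [ below ∘ ≤-pred , (λ { ≡.refl → top }) ]′ (m≤n⇒m<n∨m≡n i≤t+1)

  module AdaptedCoordinates {k n S} (flag : NestedFlats k S) (B : AdaptedBasis k n S) where
    private
      N = n k
      Y = basis B
      flats  = proj₁ (proj₂ (proj₂ flag))
      ground = proj₁ (proj₂ flag)

    spans-everything : ∀ v → InSpan Y N v
    spans-everything v with v ≈V? zeroV
    ... | yes v≈0 = (λ _ → 0#) , ≈V-trans (lc-zeroCoeffs N Y (λ _ _ → refl)) (≈V-sym v≈0)
    ... | no  v≉0 = level-spans B k ≤-refl v (ground v v≉0)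

    mem⇒coeffs-vanish : ∀ i → i ≤ k → ∀ {v c} → v ∈P S i → lc N c Y ≈V v → ∀ j → n i ≤ j → j < N → c j ≈ 0#
    mem⇒coeffs-vanish i i≤k {v} {c} v∈S lc≈v j nᵢ≤j j<N = trans c≈ (reflexive (truncate-≥ (n i) c′ j nᵢ≤j))
      where
      c′ = proj₁ (level-spans B i i≤k v v∈S)
      lc≈v′ : lc N (truncate (n i) c′) Y ≈V v
      lc≈v′ = ≈V-trans (lc-truncate (n i) N c′ Y (rank≤top B i i≤k)) (proj₂ (level-spans B i i≤k v v∈S))
      c≈ : c j ≈ truncate (n i) c′ j
      c≈ = independent⇒coeffs-unique (basis-independent B) c _ (≈V-trans lc≈v (≈V-sym lc≈v′)) j j<N

    coeffs-vanish⇒mem : ∀ i → i ≤ k → ∀ c → (∀ j → n i ≤ j → j < N → c j ≈ 0#) → NonZero (lc N c Y) →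
                        lc N c Y ∈P S i
    coeffs-vanish⇒mem i i≤k c vanish lc≉0 =
      ∈P-resp-≈V (S i) lc≈
        (flat-closed {S i} (flats i i≤k) (n i) c Y (level-members B i i≤k) (lc≉0 ∘ ≈V-trans lc≈))
      where
      lc≈ : lc N c Y ≈V lc (n i) c Y
      lc≈ = lc-zeroTail (n i) N c Y (rank≤top B i i≤k) vanish

  module LevelMap {k n S T} (S-flag : NestedFlats k S) (T-flag : NestedFlats k T)
                  (B : AdaptedBasis k n S) (C : AdaptedBasis k n T) where
    private
      module B = AdaptedCoordinates S-flag B
      module C = AdaptedCoordinates T-flag C
    open ChangeOfBasis (n k) (basis B) (basis C) (basis-independent B) B.spans-everything
                       (basis-independent C) public

    map-preserves-levels : ∀ i → i ≤ k → ∀ v → v ∈P S i → map v ∈P T i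
    map-preserves-levels i i≤k v v∈S =
      C.coeffs-vanish⇒mem i i≤k (coords v)
        (B.mem⇒coeffs-vanish i i≤k v∈S (proj₂ (B.spans-everything v)))
        (map-nonzero (nonzero (S i) v v∈S))

  evenDiffUnion-map : ∀ {k S T} (f g : V → V) → (∀ v → g (f v) ≈V v) →
                      (∀ i → i ≤ k → ∀ v → v ∈P S i → f v ∈P T i) →
                      (∀ i → i ≤ k → ∀ w → w ∈P T i → g w ∈P S i) →
                      ∀ v → evenDiffUnion k S v → evenDiffUnion k T (f v)
  evenDiffUnion-map {S = S} f g gf≈ f-levels g-levels v (j , 2j<k , v∈ , v∉) =
    j , 2j<k , f-levels _ 2j<k v v∈ ,
    λ fv∈ → v∉ (∈P-resp-≈V (S (2 *ℕ j)) (≈V-sym (gf≈ v)) (g-levels _ (≤-trans (n≤1+n _) 2j<k) _ fv∈))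

proposition2p1 : (q : ℕ) (K : FiniteField q) (r : ℕ) → 1 ≤ r →
    (k : ℕ) (E F : ℕ → PG.PointSet K r) →
    PG.NestedFlats K r k E → PG.NestedFlats K r k F →
    (∀ i → i ≤ k → Σ ℕ (λ n → PG.HasRank K r (E i) n × PG.HasRank K r (F i) n)) →
    PG.RestrIso K r (PG.evenDiffUnion K r k E) (PG.evenDiffUnion K r k F)
proposition2p1 q K r _ k E F E-flag F-flag ranks with bounded-choice ranks
... | n , same-ranks =
  linear-bijection⇒RestrIso φ.map ψ.map φ.map-linear ψ.map-linear ψ∘φ≈id φ∘ψ≈id
    (evenDiffUnion-map {k} {E} {F} φ.map ψ.map ψ∘φ≈id φ.map-preserves-levels ψ.map-preserves-levels)
    (evenDiffUnion-map {k} {F} {E} ψ.map φ.map φ∘ψ≈id ψ.map-preserves-levels φ.map-preserves-levels)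
  where
  open PG K r
  open LinearAlgebra K r
  open Flags K r
  E-basis : AdaptedBasis k n E
  E-basis = adapted-basis {k} {n} {E} E-flag (λ i i≤k → proj₁ (same-ranks i i≤k)) k ≤-refl
  F-basis : AdaptedBasis k n F
  F-basis = adapted-basis {k} {n} {F} F-flag (λ i i≤k → proj₂ (same-ranks i i≤k)) k ≤-refl
  module φ = LevelMap E-flag F-flag E-basis F-basis
  module ψ = LevelMap F-flag E-flag F-basis E-basis
  ψ∘φ≈id : ∀ v → ψ.map (φ.map v) ≈V v
  ψ∘φ≈id v = ≈V-trans (ψ.map-lc ≈V-refl) (φ.coords-spec v)
  φ∘ψ≈id : ∀ w → φ.map (ψ.map w) ≈V w
  φ∘ψ≈id w = ≈V-trans (φ.map-lc ≈V-refl) (ψ.coords-spec w)
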